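{- Let $T$ be a tree with no vertex of degree $2$, and suppose $\chi'_{CF}(T)=2$. Then for every conflict-free edge-coloring of $T$ with two colors (say red and blue), there is one color which, for every edge $e\in E(T)$, is a conflict-free color of $e$ and is the only conflict-free color of $e$.
   Context: For a graph $G$ and a vertex $v$, $E_G(v)$ denotes the set of edges incident with $v$; for an edge $uv$, its closed neighbourhood is $E_G(uv)=E_G(u)\cup E_G(v)$ (it contains $uv$ itself). Given an edge-coloring of $G$, a color is a conflict-free color of an edge $e$ if it is assigned to exactly one edge of $E_G(e)$. $G$ is conflict-free $k$-edge-colorable if there is an edge-coloring using $k$ colors in which every edge has a conflict-free color; such a coloring is a conflict-free $k$-edge-coloring. The conflict-free chromatic index $\chi'_{CF}(G)$ is the least such $k$. -}

module Defs where

open import Data.Nat using (ℕ; zero; suc; _+_; _<_)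
open import Data.Fin using (Fin; zero; suc; _≟_; inject₁; fromℕ)
open import Data.Bool using (Bool; true; false; _∨_; _∧_; if_then_else_)
open import Data.Product using (Σ; _×_; _,_; proj₁; proj₂; ∃)
open import Data.Sum using (_⊎_)
open import Relation.Nullary using (¬_)
open import Relation.Nullary.Decidable using (⌊_⌋)
open import Relation.Binary.PropositionalEquality using (_≡_)
open import Function.Definitions using (Injective)

-- A finite multigraph with vertex set Fin n and edge set Fin m;
-- each edge has two endpoints (an unordered pair, given in some order).
record Graph (n m : ℕ) : Set where
  field
    ends : Fin m → Fin n × Fin n

open Graph public

IsSimple : ∀ {n m} → Graph n m → Set
IsSimple {n} {m} G =
  (∀ e → ¬ (proj₁ (ends G e) ≡ proj₂ (ends G e))) ×
  (∀ e f → ((proj₁ (ends G e) ≡ proj₁ (ends G f)) × (proj₂ (ends G e) ≡ proj₂ (ends G f))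
           ⊎ (proj₁ (ends G e) ≡ proj₂ (ends G f)) × (proj₂ (ends G e) ≡ proj₁ (ends G f)))
         → e ≡ f)

countFin : ∀ {m} → (Fin m → Bool) → ℕ
countFin {zero} p = 0
countFin {suc m} p = (if p zero then 1 else 0) + countFin (λ i → p (suc i))

incb : ∀ {n m} → Graph n m → Fin n → Fin m → Bool
incb G v e = ⌊ proj₁ (ends G e) ≟ v ⌋ ∨ ⌊ proj₂ (ends G e) ≟ v ⌋

degree : ∀ {n m} → Graph n m → Fin n → ℕ
degree G v = countFin (incb G v)

inNbhd : ∀ {n m} → Graph n m → Fin m → Fin m → Bool
inNbhd G e f = incb G (proj₁ (ends G e)) f ∨ incb G (proj₂ (ends G e)) f

IsCFColorOf : ∀ {n m k} → Graph n m → (Fin m → Fin k) → Fin m → Fin k → Set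
IsCFColorOf G c e a = countFin (λ f → inNbhd G e f ∧ ⌊ c f ≟ a ⌋) ≡ 1

IsCFColoring : ∀ {n m k} → Graph n m → (Fin m → Fin k) → Set
IsCFColoring G c = ∀ e → ∃ λ a → IsCFColorOf G c e a

CFColorable : ∀ {n m} → Graph n m → ℕ → Set
CFColorable {n} {m} G k = Σ (Fin m → Fin k) λ c → IsCFColoring G c

CFIndexIs : ∀ {n m} → Graph n m → ℕ → Set
CFIndexIs G k = CFColorable G k × (∀ j → j < k → ¬ CFColorable G j)

Adj : ∀ {n m} → Graph n m → Fin n → Fin n → Set
Adj G u v = ∃ λ e → (proj₁ (ends G e) ≡ u × proj₂ (ends G e) ≡ v)
                  ⊎ (proj₁ (ends G e) ≡ v × proj₂ (ends G e) ≡ u)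

data Reach {n m} (G : Graph n m) : Fin n → Fin n → Set where
  here : ∀ {v} → Reach G v v
  step : ∀ {u v w} → Adj G u v → Reach G v w → Reach G u w

Connected : ∀ {n m} → Graph n m → Set
Connected G = ∀ u v → Reach G u v

-- a cycle of length k = j+3 ≥ 3: distinct vertices v₀,…,v_{k-1}
-- with v_i adjacent to v_{i+1} and v_{k-1} adjacent to v₀
HasCycle : ∀ {n m} → Graph n m → Set
HasCycle {n} G = Σ ℕ λ j → Σ (Fin (suc (suc (suc j))) → Fin n) λ v →
  Injective _≡_ _≡_ v ×
  (∀ (i : Fin (suc (suc j))) → Adj G (v (inject₁ i)) (v (suc i))) ×
  Adj G (v (fromℕ (suc (suc j)))) (v zero)

IsTree : ∀ {n m} → Graph n m → Set
IsTree {n} G = IsSimple G × Connected G × ¬ HasCycle G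

{-# OPTIONS --safe #-}

-- If two edges e, f at a vertex x had different conflict-free colours a ≠ b,
-- every edge at x would lie in E(e) and in E(f), so at most one of them is
-- coloured a and at most one b: deg x ≤ 2, hence deg x ≤ 1 as there are no
-- vertices of degree 2, and so e = f. Taking x to be either endpoint of e
-- then shows that e is the only edge of E(e), so a = c(e) = b after all.
-- Hence edges sharing a vertex share their unique conflict-free colour, and
-- connectivity spreads it over the whole tree.
module Submission where

open import Defs
open import Data.Nat using (ℕ; zero; suc; _+_; _≤_; _<_; z≤n)
open import Data.Nat.Properties
  using (≤-refl; ≤-reflexive; ≤-trans; ≤∧≢⇒<; <⇒≱; +-suc; +-mono-≤; m≤m+n; m≤n+m)
open import Data.Fin using (Fin; zero; suc; _≟_)
open import Data.Bool using (Bool; true; false; T; not; _∧_; if_then_else_)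
open import Data.Bool.Properties using (T-∧; T-∨)
open import Data.Product using (∃; _×_; _,_; proj₁; proj₂; map₁; map₂)
open import Data.Sum using (_⊎_; inj₁; inj₂)
open import Data.Sum.Function.Propositional using (_⊎-⇔_)
open import Data.Empty using (⊥-elim)
open import Function using (_∘_)
open import Function.Bundles using (Equivalence; _⇔_; mk⇔)
open import Function.Properties.Equivalence using () renaming (trans to ⇔-trans)
open import Relation.Nullary using (¬_; yes; no; contradiction)
open import Relation.Nullary.Decidable using (⌊_⌋; toWitness; fromWitness)
open import Relation.Unary using (_⊆_)
open import Relation.Binary.PropositionalEquality using (_≡_; _≢_; refl; sym; trans; cong; subst)

open Equivalence using (to; from)

private
  variable
    n m : ℕ

countFin-cong : ∀ {m} {p q : Fin m → Bool} → (∀ i → p i ≡ q i) → countFin p ≡ countFin q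
countFin-cong {zero}  p≗q = refl
countFin-cong {suc m} p≗q
  rewrite p≗q zero | countFin-cong {m} (p≗q ∘ suc) = refl

countFin-split : ∀ {m} (p q : Fin m → Bool) →
                 countFin p ≡ countFin (λ i → p i ∧ q i) + countFin (λ i → p i ∧ not (q i))
countFin-split {zero}  p q = refl
countFin-split {suc m} p q with p zero | q zero | countFin-split (p ∘ suc) (q ∘ suc)
... | true  | true  | ih = cong suc ih
... | true  | false | ih = trans (cong suc ih) (sym (+-suc _ _))
... | false | _     | ih = ih

private
  indicator-mono : ∀ {x y} → (T x → T y) → (if x then 1 else 0) ≤ (if y then 1 else 0)
  indicator-mono {false} {_}     _   = z≤n
  indicator-mono {true}  {true}  _   = ≤-refl
  indicator-mono {true}  {false} x⇒y = ⊥-elim (x⇒y _)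

  indicator-pos : ∀ {x} → T x → 1 ≤ (if x then 1 else 0)
  indicator-pos {true} _ = ≤-refl

countFin-mono : ∀ {m} {p q : Fin m → Bool} → (T ∘ p) ⊆ (T ∘ q) → countFin p ≤ countFin q
countFin-mono {zero}  p⊆q = ≤-refl
countFin-mono {suc m} p⊆q = +-mono-≤ (indicator-mono p⊆q) (countFin-mono {m} p⊆q)

countFin-∧-monoˡ : ∀ {m} {p q r : Fin m → Bool} → (T ∘ p) ⊆ (T ∘ q) →
                  countFin (λ i → p i ∧ r i) ≤ countFin (λ i → q i ∧ r i)
countFin-∧-monoˡ {p = p} {q} p⊆q = countFin-mono λ {i} →
  from (T-∧ {q i}) ∘ map₁ p⊆q ∘ to (T-∧ {p i})

countFin-pos : ∀ {m} {p : Fin m → Bool} → 1 ≤ countFin p → ∃ λ i → T (p i)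
countFin-pos {suc m} {p} pos with p zero in p₀
... | true  = zero , subst T (sym p₀) _
... | false with i , pi ← countFin-pos {m} pos = suc i , pi

countFin-≥1 : ∀ {m} {p : Fin m → Bool} {i} → T (p i) → 1 ≤ countFin p
countFin-≥1 {suc m} {i = zero}  pi = ≤-trans (indicator-pos pi) (m≤m+n _ _)
countFin-≥1 {suc m} {i = suc i} pi = ≤-trans (countFin-≥1 {m} pi) (m≤n+m _ _)

countFin-≥2 : ∀ {m} {p : Fin m → Bool} {i j} → T (p i) → T (p j) → i ≢ j → 2 ≤ countFin p
countFin-≥2 {suc m} {i = zero}  {zero}  _  _  i≢j = contradiction refl i≢j
countFin-≥2 {suc m} {i = zero}  {suc j} pi pj _   = +-mono-≤ (indicator-pos pi) (countFin-≥1 {m} pj)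
countFin-≥2 {suc m} {i = suc i} {zero}  pi pj _   = +-mono-≤ (indicator-pos pj) (countFin-≥1 {m} pi)
countFin-≥2 {suc m} {i = suc i} {suc j} pi pj i≢j =
  ≤-trans (countFin-≥2 {m} pi pj (i≢j ∘ cong suc)) (m≤n+m _ _)

not-≟-other : ∀ {a b : Fin 2} (x : Fin 2) → a ≢ b → not ⌊ x ≟ a ⌋ ≡ ⌊ x ≟ b ⌋
not-≟-other {zero}      {zero}      _          a≢b = contradiction refl a≢b
not-≟-other {zero}      {suc zero}  zero       _   = refl
not-≟-other {zero}      {suc zero}  (suc zero) _   = refl
not-≟-other {suc zero}  {zero}      zero       _   = refl
not-≟-other {suc zero}  {zero}      (suc zero) _   = refl
not-≟-other {suc zero}  {suc zero}  _          a≢b = contradiction refl a≢b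

T-≟ : ∀ {k} (x y : Fin k) → T ⌊ x ≟ y ⌋ ⇔ x ≡ y
T-≟ x y = mk⇔ (toWitness {a? = x ≟ y}) fromWitness

module _ (G : Graph n m) where

  T-incb : ∀ {v e} → T (incb G v e) ⇔ (proj₁ (ends G e) ≡ v ⊎ proj₂ (ends G e) ≡ v)
  T-incb {v} {e} = ⇔-trans (T-∨ {⌊ proj₁ (ends G e) ≟ v ⌋}) (T-≟ _ v ⊎-⇔ T-≟ _ v)

  T-inNbhd : ∀ {e f} → T (inNbhd G e f) ⇔ (T (incb G (proj₁ (ends G e)) f) ⊎ T (incb G (proj₂ (ends G e)) f))
  T-inNbhd {e} {f} = T-∨ {incb G (proj₁ (ends G e)) f}

  incb-ends₁ : ∀ e → T (incb G (proj₁ (ends G e)) e)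
  incb-ends₁ e = from T-incb (inj₁ refl)

  incb-ends₂ : ∀ e → T (incb G (proj₂ (ends G e)) e)
  incb-ends₂ e = from T-incb (inj₂ refl)

  incb⊆inNbhd : ∀ {v e} → T (incb G v e) → (T ∘ incb G v) ⊆ (T ∘ inNbhd G e)
  incb⊆inNbhd v∈e with to T-incb v∈e
  ... | inj₁ refl = from T-inNbhd ∘ inj₁
  ... | inj₂ refl = from T-inNbhd ∘ inj₂

  Adj⇒common-edge : ∀ {u v} → Adj G u v → ∃ λ e → T (incb G u e) × T (incb G v e)
  Adj⇒common-edge (e , inj₁ (refl , refl)) = e , incb-ends₁ e , incb-ends₂ e
  Adj⇒common-edge (e , inj₂ (refl , refl)) = e , incb-ends₂ e , incb-ends₁ e

  degree<2⇒incident-unique : ∀ {x e f} → degree G x < 2 → T (incb G x e) → T (incb G x f) → e ≡ f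
  degree<2⇒incident-unique {e = e} {f} deg<2 x∈e x∈f with e ≟ f
  ... | yes e≡f = e≡f
  ... | no  e≢f = contradiction (countFin-≥2 x∈e x∈f e≢f) (<⇒≱ deg<2)

  inNbhd-of-leaf-edge : ∀ {e f} → degree G (proj₁ (ends G e)) < 2 → degree G (proj₂ (ends G e)) < 2 →
                        T (inNbhd G e f) → f ≡ e
  inNbhd-of-leaf-edge {e} deg₁<2 deg₂<2 f∈E with to T-inNbhd f∈E
  ... | inj₁ u∈f = degree<2⇒incident-unique deg₁<2 u∈f (incb-ends₁ e)
  ... | inj₂ v∈f = degree<2⇒incident-unique deg₂<2 v∈f (incb-ends₂ e)

  module _ {k} (c : Fin m → Fin k) where

    CF-colour-≤1 : ∀ {p e a} → (T ∘ p) ⊆ (T ∘ inNbhd G e) → IsCFColorOf G c e a →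
                   countFin (λ f → p f ∧ ⌊ c f ≟ a ⌋) ≤ 1
    CF-colour-≤1 {p} {e} {a} p⊆E cf =
      ≤-trans (countFin-∧-monoˡ {p = p} {inNbhd G e} {λ f → ⌊ c f ≟ a ⌋} p⊆E) (≤-reflexive cf)

    CF-colour-witness : ∀ {e a} → IsCFColorOf G c e a → ∃ λ f → T (inNbhd G e f) × c f ≡ a
    CF-colour-witness {e} {a} cf
      with f , f∈E,a ← countFin-pos {p = λ f → inNbhd G e f ∧ ⌊ c f ≟ a ⌋} (≤-reflexive (sym cf))
      = f , map₂ toWitness (to (T-∧ {inNbhd G e f}) f∈E,a)

    CF-colour-of-leaf-edge : ∀ {e a} → degree G (proj₁ (ends G e)) < 2 → degree G (proj₂ (ends G e)) < 2 →
                             IsCFColorOf G c e a → c e ≡ a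
    CF-colour-of-leaf-edge deg₁<2 deg₂<2 cf
      with f , f∈E , fa ← CF-colour-witness cf
      with refl ← inNbhd-of-leaf-edge deg₁<2 deg₂<2 f∈E = fa

  module _ (c : Fin m → Fin 2) where

    countFin-by-colour : ∀ {a b} (p : Fin m → Bool) → a ≢ b →
      countFin p ≡ countFin (λ f → p f ∧ ⌊ c f ≟ a ⌋) + countFin (λ f → p f ∧ ⌊ c f ≟ b ⌋)
    countFin-by-colour p a≢b = trans (countFin-split p _)
      (cong (_ +_) (countFin-cong (λ f → cong (p f ∧_) (not-≟-other (c f) a≢b))))

    two-CF-colours⇒degree≤2 : ∀ {x e f a b} → a ≢ b →
      (T ∘ incb G x) ⊆ (T ∘ inNbhd G e) → (T ∘ incb G x) ⊆ (T ∘ inNbhd G f) →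
      IsCFColorOf G c e a → IsCFColorOf G c f b → degree G x ≤ 2
    two-CF-colours⇒degree≤2 {x} a≢b x⊆E x⊆F cfa cfb =
      ≤-trans (≤-reflexive (countFin-by-colour (incb G x) a≢b))
              (+-mono-≤ (CF-colour-≤1 c x⊆E cfa) (CF-colour-≤1 c x⊆F cfb))

module WithoutDegreeTwo (G : Graph n m) (c : Fin m → Fin 2) (no-degree-2 : ∀ v → ¬ degree G v ≡ 2) where

  two-CF-colours⇒degree<2 : ∀ {x e f a b} → a ≢ b →
    (T ∘ incb G x) ⊆ (T ∘ inNbhd G e) → (T ∘ incb G x) ⊆ (T ∘ inNbhd G f) →
    IsCFColorOf G c e a → IsCFColorOf G c f b → degree G x < 2
  two-CF-colours⇒degree<2 a≢b x⊆E x⊆F cfa cfb =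
    ≤∧≢⇒< (two-CF-colours⇒degree≤2 G c a≢b x⊆E x⊆F cfa cfb) (no-degree-2 _)

  CF-colour-unique : ∀ {e a b} → IsCFColorOf G c e a → IsCFColorOf G c e b → a ≡ b
  CF-colour-unique {e} {a} {b} cfa cfb with a ≟ b
  ... | yes a≡b = a≡b
  ... | no  a≢b = trans (sym (CF-colour-is-c cfa)) (CF-colour-is-c cfb)
    where
    endpoint-degree<2 : ∀ {x} → T (incb G x e) → degree G x < 2
    endpoint-degree<2 x∈e = two-CF-colours⇒degree<2 a≢b (incb⊆inNbhd G x∈e) (incb⊆inNbhd G x∈e) cfa cfb

    CF-colour-is-c : ∀ {a′} → IsCFColorOf G c e a′ → c e ≡ a′
    CF-colour-is-c = CF-colour-of-leaf-edge G c (endpoint-degree<2 (incb-ends₁ G e)) (endpoint-degree<2 (incb-ends₂ G e))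

  CF-colours-agree : ∀ {x e f a b} → T (incb G x e) → T (incb G x f) →
                     IsCFColorOf G c e a → IsCFColorOf G c f b → a ≡ b
  CF-colours-agree {a = a} {b} x∈e x∈f cfa cfb with a ≟ b
  ... | yes a≡b = a≡b
  ... | no  a≢b
    with refl ← degree<2⇒incident-unique G
                  (two-CF-colours⇒degree<2 a≢b (incb⊆inNbhd G x∈e) (incb⊆inNbhd G x∈f) cfa cfb) x∈e x∈f
    = CF-colour-unique cfa cfb

  CF-colours-agree-along : IsCFColoring G c → ∀ {u w e f a b} → Reach G u w →
    T (incb G u e) → T (incb G w f) → IsCFColorOf G c e a → IsCFColorOf G c f b → a ≡ b
  CF-colours-agree-along cf here u∈e w∈f cfa cfb = CF-colours-agree u∈e w∈f cfa cfb
  CF-colours-agree-along cf (step u~v v⇝w) u∈e w∈f cfa cfb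
    with g , u∈g , v∈g ← Adj⇒common-edge G u~v
    = trans (CF-colours-agree u∈e u∈g cfa (proj₂ (cf g)))
            (CF-colours-agree-along cf v⇝w v∈g w∈f (proj₂ (cf g)) cfb)

lemma1 : ∀ {n m} (T : Graph n m) → IsTree T → (∀ v → ¬ (degree T v ≡ 2)) →
    CFIndexIs T 2 → (c : Fin m → Fin 2) → IsCFColoring T c →
    ∃ λ a → ∀ e → IsCFColorOf T c e a × (∀ b → IsCFColorOf T c e b → b ≡ a)
lemma1 {m = zero}  T _                   _           _ _ _  = zero , λ ()
lemma1 {m = suc m} T (_ , connected , _) no-degree-2 _ c cf = a₀ , λ e → CF-a₀ e , λ b cfb → CF-colour-unique cfb (CF-a₀ e)
  where
  open WithoutDegreeTwo T c no-degree-2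
  a₀ : Fin 2
  a₀ = proj₁ (cf zero)
  CF-a₀ : ∀ e → IsCFColorOf T c e a₀
  CF-a₀ e = subst (IsCFColorOf T c e)
    (CF-colours-agree-along cf (connected _ _) (incb-ends₁ T e) (incb-ends₁ T zero) (proj₂ (cf e)) (proj₂ (cf zero)))
    (proj₂ (cf e))
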